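{- Let $\mathcal T\in\Sigma^n$ be a text. Then $|\mathtt{st\text{ - }pos}^-|$ is at most the number of escape symbols $\bot$ output by the following simple PPM$^*$ algorithm on $\mathcal T$: encode $\mathcal T[1]$ as $\bot\mathcal T[1]$; for $j=2,\dots,n$, let $i'$ be the minimum $i'\le j$ such that $\mathcal T[i',j-1]$ occurs in $\mathcal T[1,j-2]$; if $\mathcal T[i',j]$ occurs in $\mathcal T[1,j-1]$, encode $\mathcal T[j]$ according to the distribution of characters immediately following occurrences of $\mathcal T[i',j-1]$, and otherwise encode $\mathcal T[j]$ as $\bot\mathcal T[j]$.
   Context: A text is a string $\mathcal T\in\Sigma^n$ (1-indexed) whose last symbol $\$$ occurs only at position $n$ and is smaller than all other symbols; $\mathcal T[i,i-1]$ denotes the empty string. "Occurs in" means occurs as a substring. $\mathrm{rlce}(i,j)$ is the length of the longest common prefix of $\mathcal T[i,n],\mathcal T[j,n]$. $\mathrm{LPF}[i]=0$ if $i=1$, else $\max_{j<i}\mathrm{rlce}(j,i)$, and $\mathtt{st\text{ - }pos}^-$ is the set of distinct values $\{i+\mathrm{LPF}[i]:i\in[n]\}$. -}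

module Defs where

open import Data.Nat using (ℕ; zero; suc; _+_; _∸_; _<_; _⊔_)
open import Data.Nat.Properties using (_≟_)
open import Data.Bool using (Bool; true; false; not; if_then_else_)
open import Data.List using (List; []; _∷_; _++_; [_]; length; take; drop; map; upTo; foldr; deduplicate; filter)
open import Data.List.Membership.Propositional using (_∈_; _∉_)
open import Data.List.Relation.Binary.Infix.Heterogeneous using (Infix)
open import Data.List.Relation.Binary.Infix.Heterogeneous.Properties using (infix?)
open import Data.List.Relation.Unary.All using (All)
open import Data.Product using (Σ; _×_; ∃₂)
open import Relation.Binary.PropositionalEquality using (_≡_)
open import Relation.Nullary using (does)

-- Alphabet: Σ ⊆ ℕ (ordered by the usual order on ℕ).
-- A text is a list T = T[1] … T[n] whose last symbol $ occurs only at
-- position n and is smaller than all other symbols.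
IsText : List ℕ → Set
IsText T = ∃₂ λ (xs : List ℕ) (d : ℕ) → (T ≡ xs ++ [ d ]) × (d ∉ xs) × All (d <_) xs

range : ℕ → ℕ → List ℕ
range a b = map (a +_) (upTo (suc b ∸ a))

-- T[i, j] (1-indexed, inclusive); empty when j < i (i.e. j = i - 1).
sub : List ℕ → ℕ → ℕ → List ℕ
sub T i j = take (suc j ∸ i) (drop (i ∸ 1) T)

OccursIn : List ℕ → List ℕ → Set
OccursIn s t = Infix _≡_ s t

occurs? : List ℕ → List ℕ → Bool
occurs? s t = does (infix? _≟_ s t)

lcp : List ℕ → List ℕ → ℕ
lcp [] _ = 0
lcp (_ ∷ _) [] = 0
lcp (x ∷ xs) (y ∷ ys) = if does (x ≟ y) then suc (lcp xs ys) else 0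

rlce : List ℕ → ℕ → ℕ → ℕ
rlce T i j = lcp (drop (i ∸ 1) T) (drop (j ∸ 1) T)

maxList : List ℕ → ℕ
maxList = foldr _⊔_ 0

-- LPF[1] = 0, LPF[i] = max_{j < i} rlce(j, i)   (j ranging over [1, i-1])
LPF : List ℕ → ℕ → ℕ
LPF T i = maxList (map (λ j → rlce T j i) (range 1 (i ∸ 1)))

stPosMinus : List ℕ → List ℕ
stPosMinus T = deduplicate _≟_ (map (λ i → i + LPF T i) (range 1 (length T)))

firstWith : (ℕ → Bool) → ℕ → List ℕ → ℕ
firstWith p d [] = d
firstWith p d (x ∷ xs) = if p x then x else firstWith p d xs

-- i' = min { i' ∈ [1, j] : T[i', j-1] occurs in T[1, j-2] }
-- (i' = j always qualifies, since the empty string occurs everywhere)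
ctxStart : List ℕ → ℕ → ℕ
ctxStart T j = firstWith (λ i → occurs? (sub T i (j ∸ 1)) (sub T 1 (j ∸ 2))) j (range 1 j)

escapesAt : List ℕ → ℕ → Bool
escapesAt T j = not (occurs? (sub T (ctxStart T j) j) (sub T 1 (j ∸ 1)))

-- number of ⊥ output by the simple PPM* algorithm on T:
-- one for T[1] (encoded as ⊥T[1]), plus one for every j ∈ [2, n] that escapes
escapeCount : List ℕ → ℕ
escapeCount T = suc (length (filter (λ j → Data.Bool.T? (escapesAt T j)) (range 2 (length T))))

{-# OPTIONS --safe #-}
module Submission where

-- Send each position i to i + LPF[i].  For i = 1 this is 1, the escape that encodes T[1].
-- For i ≥ 2 put v = i + LPF[i]; then v ≤ n, since $ occurs only once and so no common prefix
-- of two distinct suffixes reaches it.  The longest previous factor T[i, v-1] occurs in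
-- T[1, v-2], so the context T[i', v-1] of step v starts at some i' ≤ i.  By maximality of
-- LPF[i], T[i, v] does not occur in T[1, v-1], hence neither does its extension T[i', v], and
-- step v escapes.  So st-pos⁻ lies inside {1} ∪ {escaping steps}.
--
-- Positions in the lemmas are 0-based: drop a T is T[a+1, n], take ℓ (drop a T) is T[a+1, a+ℓ].

open import Defs
open import Data.Nat using (ℕ; zero; suc; _+_; _∸_; _≤_; _<_; z≤n; s≤s)
open import Data.Nat.Properties
open import Data.Bool as Bool using (Bool; true; false; not; if_then_else_)
open import Data.Bool.Properties using (T-≡)
open import Data.List using (List; []; _∷_; _++_; [_]; length; take; drop; map; applyUpTo; filter)
open import Data.List.Properties
  using (length-++; length-take; length-drop; drop-drop; map-upTo; take-[]; length-removeAt′)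
open import Data.List.Membership.Propositional using (_∈_; _∉_)
open import Data.List.Membership.Propositional.Properties
  using (∈-map⁺; ∈-map⁻; ∈-upTo⁺; ∈-upTo⁻; ∈-filter⁺; ∈-deduplicate⁻)
open import Data.List.Relation.Binary.Subset.Propositional using (_⊆_)
open import Data.List.Relation.Unary.Any using (here; there; _─_)
open import Data.List.Relation.Unary.All as All using ()
open import Data.List.Relation.Unary.AllPairs using (_∷_)
open import Data.List.Relation.Unary.Unique.Propositional using (Unique)
open import Data.List.Relation.Unary.Unique.DecPropositional.Properties _≟_ using (deduplicate-!)
open import Data.List.Relation.Binary.Prefix.Heterogeneous as Prefix using (Prefix)
open import Data.List.Relation.Binary.Infix.Heterogeneous as Infix using ()
open import Data.List.Relation.Binary.Infix.Heterogeneous.Properties using (infix?)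
open import Data.Product as Product using (∃; _×_; _,_)
open import Data.Sum using (inj₁; inj₂)
open import Function using (_∘_; Equivalence)
open import Relation.Nullary using (¬_; yes; no; contradiction)
open import Relation.Nullary.Decidable using (dec-true; dec-false)
open import Relation.Binary.PropositionalEquality
  using (_≡_; _≢_; refl; sym; trans; cong; cong₂; subst; subst₂; module ≡-Reasoning)

lcp-≡ : ∀ x (xs ys : List ℕ) → lcp (x ∷ xs) (x ∷ ys) ≡ suc (lcp xs ys)
lcp-≡ x xs ys = cong (if_then suc (lcp xs ys) else 0) (dec-true (x ≟ x) refl)

lcp-≢ : ∀ {x y} (xs ys : List ℕ) → x ≢ y → lcp (x ∷ xs) (y ∷ ys) ≡ 0
lcp-≢ {x} {y} xs ys x≢y = cong (if_then suc (lcp xs ys) else 0) (dec-false (x ≟ y) x≢y)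

take-≤-lcp : ∀ m (xs ys : List ℕ) → m ≤ lcp xs ys → take m xs ≡ take m ys
take-≤-lcp zero    xs       ys       _     = refl
take-≤-lcp (suc m) (x ∷ xs) (y ∷ ys) m<lcp with x ≟ y
... | yes refl =
  cong (x ∷_) (take-≤-lcp m xs ys (≤-pred (≤-trans m<lcp (≤-reflexive (lcp-≡ x xs ys)))))
... | no x≢y   = contradiction (≤-trans m<lcp (≤-reflexive (lcp-≢ xs ys x≢y))) λ ()

Prefix⇒≤lcp : ∀ {s xs ys : List ℕ} → Prefix _≡_ s xs → Prefix _≡_ s ys → length s ≤ lcp xs ys
Prefix⇒≤lcp Prefix.[] _ = z≤n
Prefix⇒≤lcp {x ∷ _} {_ ∷ xs} {_ ∷ ys} (refl Prefix.∷ p) (refl Prefix.∷ q) =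
  ≤-trans (s≤s (Prefix⇒≤lcp p q)) (≤-reflexive (sym (lcp-≡ x xs ys)))

lcp-++-sentinel : ∀ {d} (zs ws : List ℕ) → d ∉ zs → length ws < length zs →
                  lcp (zs ++ [ d ]) (ws ++ [ d ]) ≤ length ws
lcp-++-sentinel {d} (z ∷ zs) [] d∉zs _ =
  ≤-reflexive (lcp-≢ (zs ++ [ d ]) [] (λ z≡d → d∉zs (here (sym z≡d))))
lcp-++-sentinel {d} (z ∷ zs) (w ∷ ws) d∉zs (s≤s |ws|<|zs|) with z ≟ w
... | yes refl = ≤-trans (≤-reflexive (lcp-≡ z (zs ++ [ d ]) (ws ++ [ d ])))
                         (s≤s (lcp-++-sentinel zs ws (d∉zs ∘ there) |ws|<|zs|))
... | no z≢w   = ≤-trans (≤-reflexive (lcp-≢ (zs ++ [ d ]) (ws ++ [ d ]) z≢w)) z≤n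

drop-++ˡ : ∀ n (xs ys : List ℕ) → n ≤ length xs → drop n (xs ++ ys) ≡ drop n xs ++ ys
drop-++ˡ zero    xs       ys _        = refl
drop-++ˡ (suc n) (x ∷ xs) ys (s≤s n≤) = drop-++ˡ n xs ys n≤

∉-drop : ∀ {d} n (xs : List ℕ) → d ∉ xs → d ∉ drop n xs
∉-drop zero    xs       d∉xs = d∉xs
∉-drop (suc n) []       d∉xs = d∉xs
∉-drop (suc n) (x ∷ xs) d∉xs = ∉-drop n xs (d∉xs ∘ there)

drop-take : ∀ r m (xs : List ℕ) → drop r (take m xs) ≡ take (m ∸ r) (drop r xs)
drop-take zero    m       xs       = refl
drop-take (suc r) zero    xs       = refl
drop-take (suc r) (suc m) []       = sym (take-[] (m ∸ r))
drop-take (suc r) (suc m) (x ∷ xs) = drop-take r m xs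

drop-take-drop : ∀ {c a} j (xs : List ℕ) → c ≤ a →
                 drop (a ∸ c) (take (j ∸ c) (drop c xs)) ≡ take (j ∸ a) (drop a xs)
drop-take-drop {c} {a} j xs c≤a = begin
  drop (a ∸ c) (take (j ∸ c) (drop c xs))
    ≡⟨ drop-take (a ∸ c) (j ∸ c) (drop c xs) ⟩
  take (j ∸ c ∸ (a ∸ c)) (drop (a ∸ c) (drop c xs))
    ≡⟨ cong₂ take (∸-+-assoc j c (a ∸ c)) (drop-drop c (a ∸ c) xs) ⟩
  take (j ∸ (c + (a ∸ c))) (drop (c + (a ∸ c)) xs)
    ≡⟨ cong (λ n → take (j ∸ n) (drop n xs)) (m+[n∸m]≡n c≤a) ⟩
  take (j ∸ a) (drop a xs)
    ∎
  where open ≡-Reasoning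

length-take-drop : ∀ k ℓ (xs : List ℕ) → k + ℓ ≤ length xs → length (take ℓ (drop k xs)) ≡ ℓ
length-take-drop k ℓ xs k+ℓ≤|xs| = trans (length-take ℓ (drop k xs)) (m≤n⇒m⊓n≡m ℓ≤|xs[k…]|)
  where
  ℓ≤|xs[k…]| : ℓ ≤ length (drop k xs)
  ℓ≤|xs[k…]| = subst (ℓ ≤_) (sym (length-drop k xs))
                 (m+n≤o⇒m≤o∸n ℓ (subst (_≤ length xs) (+-comm k ℓ) k+ℓ≤|xs|))

take-Prefix : ∀ n (xs : List ℕ) → Prefix _≡_ (take n xs) xs
take-Prefix zero    xs       = Prefix.[]
take-Prefix (suc n) []       = Prefix.[]
take-Prefix (suc n) (x ∷ xs) = refl Prefix.∷ take-Prefix n xs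

take-≤-Prefix : ∀ {ℓ m} → ℓ ≤ m → (xs : List ℕ) → Prefix _≡_ (take ℓ xs) (take m xs)
take-≤-Prefix z≤n      xs       = Prefix.[]
take-≤-Prefix (s≤s _)  []       = Prefix.[]
take-≤-Prefix (s≤s ℓ≤) (x ∷ xs) = refl Prefix.∷ take-≤-Prefix ℓ≤ xs

Prefix-take⁻ : ∀ {s} m (xs : List ℕ) → Prefix _≡_ s (take m xs) → length s ≤ m × Prefix _≡_ s xs
Prefix-take⁻ (suc m) (x ∷ xs) (refl Prefix.∷ p) =
  Product.map s≤s (refl Prefix.∷_) (Prefix-take⁻ m xs p)
Prefix-take⁻ _       _        Prefix.[]          = z≤n , Prefix.[]

take-drop-OccursIn : ∀ k ℓ m (xs : List ℕ) → k + ℓ ≤ m → OccursIn (take ℓ (drop k xs)) (take m xs)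
take-drop-OccursIn zero    ℓ m       xs       ℓ≤m         = Infix.here (take-≤-Prefix ℓ≤m xs)
take-drop-OccursIn (suc k) ℓ m       []       _           =
  subst (λ s → OccursIn s (take m [])) (sym (take-[] ℓ)) (Infix.here Prefix.[])
take-drop-OccursIn (suc k) ℓ (suc m) (x ∷ xs) (s≤s k+ℓ≤m) =
  Infix.there (take-drop-OccursIn k ℓ m xs k+ℓ≤m)

OccursIn-take⇒Prefix-drop : ∀ {s} m (xs : List ℕ) → OccursIn s (take m xs) →
                            ∃ λ k → k + length s ≤ m × Prefix _≡_ s (drop k xs)
OccursIn-take⇒Prefix-drop (suc m) (x ∷ xs) (Infix.there occ) with OccursIn-take⇒Prefix-drop m xs occ
... | k , k+|s|≤m , p = suc k , s≤s k+|s|≤m , p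
OccursIn-take⇒Prefix-drop m       xs       (Infix.here p)    = 0 , Prefix-take⁻ m xs p

OccursIn-drop : ∀ r {s t : List ℕ} → OccursIn s t → OccursIn (drop r s) t
OccursIn-drop zero            occ                          = occ
OccursIn-drop (suc r) {[]}    occ                          = occ
OccursIn-drop (suc r) {_ ∷ _} (Infix.here (_ Prefix.∷ p)) = Infix.there (OccursIn-drop r (Infix.here p))
OccursIn-drop (suc r) {_ ∷ _} (Infix.there occ)            = Infix.there (OccursIn-drop (suc r) occ)

lcp-maximal⇒¬OccursIn : ∀ {xs : List ℕ} {a L} → a + L < length xs →
                         (∀ {k} → k < a → lcp (drop k xs) (drop a xs) ≤ L) →
                         ¬ OccursIn (take (suc L) (drop a xs)) (take (a + L) xs)
lcp-maximal⇒¬OccursIn {xs} {a} {L} a+L<n lcp≤L occ =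
  no-earlier-start (OccursIn-take⇒Prefix-drop (a + L) xs occ)
  where
  s = take (suc L) (drop a xs)
  |s|≡1+L : length s ≡ suc L
  |s|≡1+L = length-take-drop a (suc L) xs (subst (_≤ length xs) (sym (+-suc a L)) a+L<n)
  no-earlier-start : ¬ ∃ λ k → k + length s ≤ a + L × Prefix _≡_ s (drop k xs)
  no-earlier-start (k , k+|s|≤a+L , s≼xs[k…]) = <-irrefl refl (begin-strict
    L                           <⟨ n<1+n L ⟩
    suc L                       ≡⟨ |s|≡1+L ⟨
    length s                    ≤⟨ Prefix⇒≤lcp s≼xs[k…] (take-Prefix (suc L) (drop a xs)) ⟩
    lcp (drop k xs) (drop a xs) ≤⟨ lcp≤L k<a ⟩
    L                           ∎)
    where
    open ≤-Reasoning
    k<a : k < a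
    k<a = +-cancelʳ-≤ L (suc k) a
      (subst (_≤ a + L) (+-suc k L) (subst (λ n → k + n ≤ a + L) |s|≡1+L k+|s|≤a+L))

firstWith-applyUpTo : ∀ (p : ℕ → Bool) d f {c k} → k < c → p (f k) ≡ true →
                      ∃ λ k′ → k′ ≤ k × firstWith p d (applyUpTo f c) ≡ f k′
firstWith-applyUpTo p d f {suc c} {k} k<c pfk with p (f 0) in pf0
... | true = 0 , z≤n , refl
firstWith-applyUpTo p d f {suc c} {zero}  _         pfk | false =
  contradiction (trans (sym pfk) pf0) λ ()
firstWith-applyUpTo p d f {suc c} {suc k} (s≤s k<c) pfk | false
  with k′ , k′≤k , eq ← firstWith-applyUpTo p d (f ∘ suc) k<c pfk = suc k′ , s≤s k′≤k , eq

≤-maxList : ∀ {x xs} → x ∈ xs → x ≤ maxList xs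
≤-maxList {xs = y ∷ ys} (here refl) = m≤m⊔n y (maxList ys)
≤-maxList {xs = y ∷ ys} (there x∈)  = ≤-trans (≤-maxList x∈) (m≤n⊔m y (maxList ys))

maxList-∈ : ∀ x xs → maxList (x ∷ xs) ∈ x ∷ xs
maxList-∈ x []       = here (⊔-identityʳ x)
maxList-∈ x (y ∷ ys) with ⊔-sel x (maxList (y ∷ ys))
... | inj₁ e = here e
... | inj₂ e = there (subst (_∈ y ∷ ys) (sym e) (maxList-∈ y ys))

∈-─ : ∀ {A : Set} {x z : A} ys (x∈ys : x ∈ ys) → z ∈ ys → z ≢ x → z ∈ (ys ─ x∈ys)
∈-─ (y ∷ ys) (here refl) (here refl) z≢x = contradiction refl z≢x
∈-─ (y ∷ ys) (here refl) (there z∈)  _   = z∈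
∈-─ (y ∷ ys) (there x∈)  (here refl) _   = here refl
∈-─ (y ∷ ys) (there x∈)  (there z∈)  z≢x = there (∈-─ ys x∈ z∈ z≢x)

Unique-⊆⇒length-≤ : ∀ {A : Set} {xs ys : List A} → Unique xs → xs ⊆ ys → length xs ≤ length ys
Unique-⊆⇒length-≤ {xs = []}     _            _     = z≤n
Unique-⊆⇒length-≤ {xs = x ∷ xs} {ys} (x∉xs ∷ u) xs⊆ys = begin
  suc (length xs)                       ≤⟨ s≤s (Unique-⊆⇒length-≤ u xs⊆ys─x) ⟩
  suc (length (ys ─ xs⊆ys (here refl))) ≡⟨ length-removeAt′ ys _ ⟨
  length ys                             ∎
  where
  open ≤-Reasoning
  xs⊆ys─x : xs ⊆ (ys ─ xs⊆ys (here refl))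
  xs⊆ys─x z∈xs = ∈-─ ys _ (xs⊆ys (there z∈xs)) (λ { refl → All.lookup x∉xs z∈xs refl })

sub-suc : ∀ (T : List ℕ) a ℓ → sub T (suc a) (a + ℓ) ≡ take ℓ (drop a T)
sub-suc T a ℓ = cong (λ n → take n (drop a T)) (m+n∸m≡n a ℓ)

escapes : List ℕ → List ℕ
escapes T = filter (λ j → Bool.T? (escapesAt T j)) (range 2 (length T))

ctxStart-≤ : ∀ T {j} a → a < j → OccursIn (sub T (suc a) (j ∸ 1)) (sub T 1 (j ∸ 2)) →
             ∃ λ c → c ≤ a × ctxStart T j ≡ suc c
ctxStart-≤ T {j} a a<j occ =
  over-range (firstWith-applyUpTo p j suc a<j (dec-true (infix? _≟_ _ _) occ))
  where
  p : ℕ → Bool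
  p i = occurs? (sub T i (j ∸ 1)) (sub T 1 (j ∸ 2))
  over-range : (∃ λ c → c ≤ a × firstWith p j (applyUpTo suc j) ≡ suc c) →
               ∃ λ c → c ≤ a × ctxStart T j ≡ suc c
  over-range (c , c≤a , eq) = c , c≤a , trans (cong (firstWith p j) (map-upTo suc j)) eq

¬OccursIn⇒escapesAt : ∀ T {m} a → (∃ λ c → c ≤ a × ctxStart T (suc m) ≡ suc c) →
                       ¬ OccursIn (sub T (suc a) (suc m)) (take m T) → escapesAt T (suc m) ≡ true
¬OccursIn⇒escapesAt T {m} a (c , c≤a , ctx) ¬occ = begin
  escapesAt T (suc m)
    ≡⟨ cong (λ i → not (occurs? (sub T i (suc m)) (take m T))) ctx ⟩
  not (occurs? (sub T (suc c) (suc m)) (take m T))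
    ≡⟨ cong not (dec-false (infix? _≟_ _ _) (¬occ ∘ suffix)) ⟩
  true
    ∎
  where
  open ≡-Reasoning
  suffix : OccursIn (sub T (suc c) (suc m)) (take m T) → OccursIn (sub T (suc a) (suc m)) (take m T)
  suffix occ = subst (λ s → OccursIn s (take m T)) (drop-take-drop (suc m) T c≤a)
                 (OccursIn-drop (a ∸ c) occ)

rlce-bound : ∀ {T} → IsText T → ∀ {b a} → b < a → a < length T →
             suc a + rlce T (suc b) (suc a) ≤ length T
rlce-bound (xs , d , refl , d∉xs , _) {b} {a} b<a a<n = begin-strict
  a + lcp (drop b (xs ++ [ d ])) (drop a (xs ++ [ d ]))
    ≡⟨ cong₂ (λ u w → a + lcp u w) (drop-++ˡ b xs [ d ] b≤|xs|) (drop-++ˡ a xs [ d ] a≤|xs|) ⟩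
  a + lcp (drop b xs ++ [ d ]) (drop a xs ++ [ d ])
    ≤⟨ +-monoʳ-≤ a (lcp-++-sentinel _ _ (∉-drop b xs d∉xs) |xs[a…]|<|xs[b…]|) ⟩
  a + length (drop a xs)  ≡⟨ cong (a +_) (length-drop a xs) ⟩
  a + (length xs ∸ a)     ≡⟨ m+[n∸m]≡n a≤|xs| ⟩
  length xs               <⟨ m<m+n (length xs) (s≤s z≤n) ⟩
  length xs + 1           ≡⟨ length-++ xs ⟨
  length (xs ++ [ d ])    ∎
  where
  open ≤-Reasoning
  a≤|xs| : a ≤ length xs
  a≤|xs| = ≤-pred (subst (a <_) (trans (length-++ xs) (+-comm (length xs) 1)) a<n)
  b≤|xs| : b ≤ length xs
  b≤|xs| = ≤-trans (<⇒≤ b<a) a≤|xs|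
  |xs[a…]|<|xs[b…]| : length (drop a xs) < length (drop b xs)
  |xs[a…]|<|xs[b…]| =
    subst₂ _<_ (sym (length-drop a xs)) (sym (length-drop b xs)) (∸-monoʳ-< b<a a≤|xs|)

rlce-≤-LPF : ∀ T {b a} → b < a → rlce T (suc b) (suc a) ≤ LPF T (suc a)
rlce-≤-LPF T {b} {a} b<a =
  ≤-maxList (∈-map⁺ (λ j → rlce T j (suc a)) (∈-map⁺ (1 +_) (∈-upTo⁺ b<a)))

LPF-∈ : ∀ T {a} → 0 < a → LPF T (suc a) ∈ map (λ j → rlce T j (suc a)) (range 1 a)
LPF-∈ T {suc _} _ = maxList-∈ _ _

LPF-attained : ∀ T {a} → 0 < a → ∃ λ b → b < a × LPF T (suc a) ≡ rlce T (suc b) (suc a)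
LPF-attained T {a} 0<a with j , j∈ , LPF≡ ← ∈-map⁻ (λ j → rlce T j (suc a)) (LPF-∈ T 0<a)
                         with b , b∈ , refl ← ∈-map⁻ (1 +_) j∈ = b , ∈-upTo⁻ b∈ , LPF≡

LPF-bound : ∀ {T} → IsText T → ∀ {a} → 0 < a → a < length T → a + LPF T (suc a) < length T
LPF-bound {T} txt {a} 0<a a<n with b , b<a , LPF≡ ← LPF-attained T 0<a =
  subst (λ ℓ → a + ℓ < length T) (sym LPF≡) (rlce-bound txt b<a a<n)

LPF-recurs : ∀ T {a} → 0 < a →
             OccursIn (take (LPF T (suc a)) (drop a T)) (take (a ∸ 1 + LPF T (suc a)) T)
LPF-recurs T {a@(suc a₀)} 0<a with b , b<a , LPF≡ ← LPF-attained T 0<a =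
  subst (λ s → OccursIn s (take (a₀ + L) T))
    (take-≤-lcp L (drop b T) (drop a T) (≤-reflexive LPF≡))
    (take-drop-OccursIn b L (a₀ + L) T (+-monoˡ-≤ L (≤-pred b<a)))
  where L = LPF T (suc a)

LPF-escapes : ∀ {T} → IsText T → ∀ {a} → 0 < a → a < length T → suc a + LPF T (suc a) ∈ escapes T
LPF-escapes {T} txt {a@(suc a₀)} 0<a a<n =
  ∈-filter⁺ (Bool.T? ∘ escapesAt T) (∈-map⁺ (2 +_) (∈-upTo⁺ (suc[m]≤n⇒m≤pred[n] a+L<n)))
    (Equivalence.from T-≡ escapes-v)
  where
  L = LPF T (suc a)
  a+L<n : a + L < length T
  a+L<n = LPF-bound txt 0<a a<n
  context : ∃ λ c → c ≤ a × ctxStart T (suc (a + L)) ≡ suc c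
  context = ctxStart-≤ T a (s≤s (m≤m+n a L))
    (subst (λ s → OccursIn s (take (a₀ + L) T)) (sym (sub-suc T a L)) (LPF-recurs T 0<a))
  extension : sub T (suc a) (suc (a + L)) ≡ take (suc L) (drop a T)
  extension = trans (cong (sub T (suc a)) (sym (+-suc a L))) (sub-suc T a (suc L))
  escapes-v : escapesAt T (suc (a + L)) ≡ true
  escapes-v = ¬OccursIn⇒escapesAt T a context
    (subst (λ s → ¬ OccursIn s (take (a + L) T)) (sym extension)
      (lcp-maximal⇒¬OccursIn a+L<n (rlce-≤-LPF T)))

lemma47 : (T : List ℕ) → IsText T → length (stPosMinus T) ≤ escapeCount T
lemma47 T txt = Unique-⊆⇒length-≤ (deduplicate-! _) stPosMinus⊆
  where
  stPosMinus⊆ : stPosMinus T ⊆ 1 ∷ escapes T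
  stPosMinus⊆ x∈ with ∈-map⁻ (λ i → i + LPF T i) (∈-deduplicate⁻ _≟_ _ x∈)
  ... | i , i∈ , refl with ∈-map⁻ (1 +_) i∈
  ...   | zero   , _  , refl = here refl
  ...   | suc a₀ , a∈ , refl = there (LPF-escapes txt (s≤s z≤n) (∈-upTo⁻ a∈))
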